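{- Let $n\ge 4$ be an integer, let $v=2^n-7$, and let $\Sigma=(X,\mathcal B)$ be a Steiner triple system of order $v$ having a maximal independent set $T$ with $|T|=\frac{v-1}{2}$. Then there exists a Steiner triple system $\Sigma'=(X',\mathcal B')$ of order $v'=2^{n+1}-7$ embedding $\Sigma$ (i.e. $X\subseteq X'$, $\mathcal B\subseteq\mathcal B'$) which has a maximal independent set $T'$ with $T\subseteq T'$ and $|T'|=\frac{v'-1}{2}$.
   Context: A Steiner triple system of order $v$ is a pair $(X,\mathcal B)$ with $|X|=v$ and $\mathcal B$ a family of $3$-subsets of $X$ (blocks) such that every $2$-subset of $X$ lies in exactly one block. An independent set is a subset of $X$ containing no block; it is maximal if it is not properly contained in another independent set. For $v\equiv 1,9\pmod{12}$ (which holds for $v=2^n-7$), $\frac{v-1}{2}$ is the largest possible cardinality of a maximal independent set. -}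

module Defs where

open import Level using (0ℓ)
open import Data.Nat using (ℕ; suc)
open import Data.Fin using (Fin)
open import Data.Fin.Subset using (Subset; _∈_; _∉_; _⊆_; ∣_∣)
open import Data.Product using (Σ; _×_; ∃!)
open import Relation.Binary.PropositionalEquality using (_≡_; _≢_)
open import Relation.Nullary using (¬_)
open import Function.Bundles using (_⇔_)
open import Function.Definitions using (Injective)

record STS (v : ℕ) : Set₁ where
  field
    IsBlock     : Subset v → Set
    block-size  : ∀ B → IsBlock B → ∣ B ∣ ≡ 3
    pair-unique : ∀ (x y : Fin v) → x ≢ y →
                  ∃! _≡_ (λ B → IsBlock B × (x ∈ B × y ∈ B))
open STS public

Independent : ∀ {v} → STS v → Subset v → Set
Independent S T = ∀ B → IsBlock S B → ¬ (B ⊆ T)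

MaximalIndependent : ∀ {v} → STS v → Subset v → Set
MaximalIndependent S T =
  Independent S T × (∀ U → Independent S U → T ⊆ U → U ⊆ T)

-- Σ' embeds Σ via an injection f : X → X' (identifying X with a subset of X')
-- such that the image of every block of Σ is a block of Σ'.
IsEmbedding : ∀ {v v'} → STS v → STS v' → (Fin v → Fin v') → Set
IsEmbedding {v} {v'} S S' f =
  Injective _≡_ _≡_ f ×
  (∀ B → IsBlock S B →
     Σ (Subset v') λ B' → IsBlock S' B' ×
       (∀ y → (y ∈ B') ⇔ Σ (Fin v) λ x → x ∈ B × f x ≡ y))

-- A Steiner triple system is the same thing as a Steiner quasigroup, x · y being the third point
-- of the block through x ≠ y; its maximal independent sets are the product-free sets T that are
-- saturated: every point outside T is the product of two distinct points of T.
--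
-- Let v = 2ⁿ − 7 and Y = 𝔽₂³ × 𝔽₂ⁿ⁻³, so |Y| = 2ⁿ. Label the points of X injectively by the
-- elements of Y outside the seven-point hole (𝔽₂³ ∖ {c₀}) × {0}, the points of T receiving labels
-- with first coordinate 1. On X ⊎ Y put x * x′ = x · x′, x * y = y + label x and, for y ≠ z in Y,
-- y * z = label⁻¹ (y + z) if y + z is a label; otherwise y and z lie in a common coset 𝔽₂³ × {w},
-- and y * z is the third point of their triangle in a fixed decomposition of K₈ minus the
-- matching p ↔ p + c₀. This is a Steiner quasigroup on v + 2ⁿ = 2ⁿ⁺¹ − 7 points containing X.
-- The set T′ = T ∪ {y : y₁ = 0} is product-free because the first coordinate is additive, the
-- labels of T have first coordinate 1 and no local triangle lies in {y₁ = 0}. It is saturated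
-- because a point of X ∖ T already is a product in T, and y with y₁ = 1 equals t₀ * (y + label t₀)
-- for any t₀ ∈ T. Finally |T′| = |T| + 2ⁿ⁻¹ = (2ⁿ⁺¹ − 8) / 2.

module Submission where

open import Defs
open import Data.Nat using (ℕ; _≤_; _∸_; _^_; _+_; _*_)
open import Data.Fin using (Fin)
open import Data.Fin.Subset using (Subset; _∈_; ∣_∣)
open import Data.Product using (Σ; _×_)
open import Relation.Binary.PropositionalEquality using (_≡_)

open import Data.Bool using (Bool; true; false; _xor_; _∧_; _∨_; if_then_else_)
open import Data.Bool.Properties using (¬-not; xor-comm; xor-assoc; xor-same; xor-identityʳ)
  renaming (_≟_ to _≟ᵇ_)
open import Data.Fin using (zero; suc; _↑ˡ_; _↑ʳ_)
open import Data.Fin.Properties using (any?; +↔⊎; *↔×) renaming (_≟_ to _≟ᶠ_)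
open import Data.Fin.Subset using (_∉_; _⊆_; ⁅_⁆; _∪_; ⊥; ⊤; ∁; Nonempty)
open import Data.Fin.Subset.Properties
  using ( _∈?_; ⊆-antisym; p⊆q⇒∣p∣≤∣q∣; p⊂q⇒∣p∣<∣q∣; x∈⁅x⁆; x∈⁅y⁆⇒x≡y; x∈⁅y⁆⇔x≡y; x≢y⇒x∉⁅y⁆
        ; x∉⁅y⁆⇒x≢y; x∈p∪q⁻; x∈p∪q⁺; ∪-identityˡ; ∈⊤; ∉⊥; ∣⁅x⁆∣≡1; ∣⊥∣≡0; ∣⊤∣≡n; ∣∁p∣≡n∸∣p∣)
open import Data.List using (List; []; _∷_)
open import Data.Maybe using (Maybe; just; nothing)
import Data.Maybe as Maybe
open import Data.Maybe.Properties using (map-nothing)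
open import Data.Nat using (zero; suc; _<_; s≤s; z≤n)
open import Data.Nat.Properties
  using (<⇒≱; ≤-reflexive; n<1+n; +-identityʳ; +-comm; +-suc; m+n∸n≡m; *-cancelˡ-≡; +-cancelʳ-≡)
open import Data.Nat.Tactic.RingSolver using (solve-∀)
open import Data.Product using (_,_; proj₁; proj₂; ∃; ∃₂; uncurry)
open import Data.Product.Algebra using (×-cong)
open import Data.Product.Properties using () renaming (≡-dec to ×-≡-dec)
open import Data.Sum using (_⊎_; inj₁; inj₂; [_,_]′)
import Data.Sum as Sum
open import Data.Sum.Algebra using (⊎-cong)
open import Data.Sum.Properties using (inj₁-injective)
open import Data.Vec using (Vec; []; _∷_; here; there; uncons; replicate; zipWith; head; lookup; _++_)
open import Data.Vec.Properties
  using (zipWith-comm; zipWith-identityʳ; lookup-++ˡ; lookup-++ʳ; []=⇒lookup; lookup⇒[]=)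
  renaming (≡-dec to Vec-≡-dec)
open import Function.Base using (id; _∘′_)
open import Function.Bundles using (_⇔_; mk⇔; Equivalence; _↔_; mk↔ₛ′; Inverse; Injection)
open import Function.Definitions using (Injective)
open import Function.Properties.Equivalence using () renaming (trans to ⇔-trans)
open import Function.Properties.Inverse using (↔⇒↣; ↔-refl; ↔-sym; ↔-trans)
open import Relation.Binary.Definitions using (DecidableEquality)
open import Relation.Binary.PropositionalEquality
  using (_≢_; refl; sym; trans; cong; cong₂; subst; subst₂; ≢-sym; module ≡-Reasoning)
open import Relation.Nullary using (¬_; Dec; yes; no; does; contradiction)
open import Relation.Nullary.Decidable using (¬?; _×-dec_; _→-dec_; map′; from-yes)


private variable
  n : ℕ

-- Finite sets

⟨_,_,_⟩ : Fin n → Fin n → Fin n → Subset n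
⟨ a , b , c ⟩ = ⁅ a ⁆ ∪ ⁅ b ⁆ ∪ ⁅ c ⁆

module _ {a b c : Fin n} where

  ∈⟨⟩⁻ : ∀ {z} → z ∈ ⟨ a , b , c ⟩ → z ≡ a ⊎ z ≡ b ⊎ z ≡ c
  ∈⟨⟩⁻ z∈ with x∈p∪q⁻ ⁅ a ⁆ _ z∈
  ... | inj₁ z∈a = inj₁ (x∈⁅y⁆⇒x≡y a z∈a)
  ... | inj₂ z∈bc with x∈p∪q⁻ ⁅ b ⁆ _ z∈bc
  ...   | inj₁ z∈b = inj₂ (inj₁ (x∈⁅y⁆⇒x≡y b z∈b))
  ...   | inj₂ z∈c = inj₂ (inj₂ (x∈⁅y⁆⇒x≡y c z∈c))

  a∈⟨⟩ : a ∈ ⟨ a , b , c ⟩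
  a∈⟨⟩ = x∈p∪q⁺ (inj₁ (x∈⁅x⁆ a))

  b∈⟨⟩ : b ∈ ⟨ a , b , c ⟩
  b∈⟨⟩ = x∈p∪q⁺ (inj₂ (x∈p∪q⁺ (inj₁ (x∈⁅x⁆ b))))

  c∈⟨⟩ : c ∈ ⟨ a , b , c ⟩
  c∈⟨⟩ = x∈p∪q⁺ (inj₂ (x∈p∪q⁺ (inj₂ (x∈⁅x⁆ c))))

  ∈⟨⟩⁺ : ∀ {z} → z ≡ a ⊎ z ≡ b ⊎ z ≡ c → z ∈ ⟨ a , b , c ⟩
  ∈⟨⟩⁺ (inj₁ refl)        = a∈⟨⟩
  ∈⟨⟩⁺ (inj₂ (inj₁ refl)) = b∈⟨⟩
  ∈⟨⟩⁺ (inj₂ (inj₂ refl)) = c∈⟨⟩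

  ⟨⟩⊆ : ∀ {p} → a ∈ p → b ∈ p → c ∈ p → ⟨ a , b , c ⟩ ⊆ p
  ⟨⟩⊆ a∈p b∈p c∈p z∈ with ∈⟨⟩⁻ z∈
  ... | inj₁ refl        = a∈p
  ... | inj₂ (inj₁ refl) = b∈p
  ... | inj₂ (inj₂ refl) = c∈p

∣⁅x⁆∪p∣≡1+∣p∣ : ∀ {x : Fin n} {p} → x ∉ p → ∣ ⁅ x ⁆ ∪ p ∣ ≡ suc ∣ p ∣
∣⁅x⁆∪p∣≡1+∣p∣ {x = zero}  {true  ∷ p} x∉p = contradiction here x∉p
∣⁅x⁆∪p∣≡1+∣p∣ {x = zero}  {false ∷ p} _   = cong (suc ∘′ ∣_∣) (∪-identityˡ p)
∣⁅x⁆∪p∣≡1+∣p∣ {x = suc x} {true  ∷ p} x∉p = cong suc (∣⁅x⁆∪p∣≡1+∣p∣ (x∉p ∘′ there))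
∣⁅x⁆∪p∣≡1+∣p∣ {x = suc x} {false ∷ p} x∉p = ∣⁅x⁆∪p∣≡1+∣p∣ (x∉p ∘′ there)

∣⟨⟩∣≡3 : ∀ {a b c : Fin n} → a ≢ b → a ≢ c → b ≢ c → ∣ ⟨ a , b , c ⟩ ∣ ≡ 3
∣⟨⟩∣≡3 {a = a} {b} {c} a≢b a≢c b≢c = begin
  ∣ ⁅ a ⁆ ∪ ⁅ b ⁆ ∪ ⁅ c ⁆ ∣  ≡⟨ ∣⁅x⁆∪p∣≡1+∣p∣ a∉bc ⟩
  suc ∣ ⁅ b ⁆ ∪ ⁅ c ⁆ ∣      ≡⟨ cong suc (∣⁅x⁆∪p∣≡1+∣p∣ (x≢y⇒x∉⁅y⁆ b≢c)) ⟩
  suc (suc ∣ ⁅ c ⁆ ∣)        ≡⟨ cong (suc ∘′ suc) (∣⁅x⁆∣≡1 c) ⟩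
  3                          ∎
  where
  open ≡-Reasoning
  a∉bc : a ∉ ⁅ b ⁆ ∪ ⁅ c ⁆
  a∉bc a∈bc with x∈p∪q⁻ ⁅ b ⁆ _ a∈bc
  ... | inj₁ a∈b = a≢b (x∈⁅y⁆⇒x≡y b a∈b)
  ... | inj₂ a∈c = a≢c (x∈⁅y⁆⇒x≡y c a∈c)

∣p∣<∣q∣⇒∃∈q∉p : ∀ {p q : Subset n} → ∣ p ∣ < ∣ q ∣ → ∃ λ x → x ∈ q × x ∉ p
∣p∣<∣q∣⇒∃∈q∉p {p = p} {q} ∣p∣<∣q∣ with any? (λ x → x ∈? q ×-dec ¬? (x ∈? p))
... | yes found = found
... | no none   = contradiction (p⊆q⇒∣p∣≤∣q∣ q⊆p) (<⇒≱ ∣p∣<∣q∣)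
  where
  q⊆p : q ⊆ p
  q⊆p {x} x∈q with x ∈? p
  ... | yes x∈p = x∈p
  ... | no x∉p  = contradiction (x , x∈q , x∉p) none

p⊆q∧∣q∣≤∣p∣⇒p≡q : ∀ {p q : Subset n} → p ⊆ q → ∣ q ∣ ≤ ∣ p ∣ → p ≡ q
p⊆q∧∣q∣≤∣p∣⇒p≡q {p = p} {q} p⊆q ∣q∣≤∣p∣ = ⊆-antisym p⊆q q⊆p
  where
  q⊆p : q ⊆ p
  q⊆p {x} x∈q with x ∈? p
  ... | yes x∈p = x∈p
  ... | no x∉p  = contradiction ∣q∣≤∣p∣ (<⇒≱ (p⊂q⇒∣p∣<∣q∣ (p⊆q , x , x∈q , x∉p)))

∣B∣≡3⇒B≡⟨⟩ : ∀ {B : Subset n} {a b c} → ∣ B ∣ ≡ 3 → a ∈ B → b ∈ B → c ∈ B →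
              a ≢ b → a ≢ c → b ≢ c → B ≡ ⟨ a , b , c ⟩
∣B∣≡3⇒B≡⟨⟩ ∣B∣≡3 a∈B b∈B c∈B a≢b a≢c b≢c =
  sym (p⊆q∧∣q∣≤∣p∣⇒p≡q (⟨⟩⊆ a∈B b∈B c∈B) (≤-reflexive (trans ∣B∣≡3 (sym (∣⟨⟩∣≡3 a≢b a≢c b≢c)))))

∣p++q∣≡∣p∣+∣q∣ : ∀ {m} (p : Subset m) (q : Subset n) → ∣ p ++ q ∣ ≡ ∣ p ∣ + ∣ q ∣
∣p++q∣≡∣p∣+∣q∣ []          q = refl
∣p++q∣≡∣p∣+∣q∣ (true  ∷ p) q = cong suc (∣p++q∣≡∣p∣+∣q∣ p q)
∣p++q∣≡∣p∣+∣q∣ (false ∷ p) q = ∣p++q∣≡∣p∣+∣q∣ p q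

∈-resp-lookup : ∀ {m} {p : Subset m} {q : Subset n} {i j} → lookup p i ≡ lookup q j → i ∈ p ⇔ j ∈ q
∈-resp-lookup {p = p} {q} {i} {j} pi≡qj =
  mk⇔ (λ i∈p → lookup⇒[]= j q (trans (sym pi≡qj) ([]=⇒lookup i∈p)))
      (λ j∈q → lookup⇒[]= i p (trans pi≡qj ([]=⇒lookup j∈q)))

↑ˡ∈++⇔ : ∀ {m} (p : Subset m) {q : Subset n} {i} → i ↑ˡ n ∈ p ++ q ⇔ i ∈ p
↑ˡ∈++⇔ p {q} {i} = ∈-resp-lookup (lookup-++ˡ p q i)

↑ʳ∈++⇔ : ∀ {m} (p : Subset m) {q : Subset n} {i} → m ↑ʳ i ∈ p ++ q ⇔ i ∈ q
↑ʳ∈++⇔ p {q} {i} = ∈-resp-lookup (lookup-++ʳ p q i)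

split : (p : Subset n) → Fin n → Fin ∣ p ∣ ⊎ Fin ∣ ∁ p ∣
split (true  ∷ p) zero    = inj₁ zero
split (true  ∷ p) (suc x) = Sum.map₁ suc (split p x)
split (false ∷ p) zero    = inj₂ zero
split (false ∷ p) (suc x) = Sum.map₂ suc (split p x)

unsplit : (p : Subset n) → Fin ∣ p ∣ ⊎ Fin ∣ ∁ p ∣ → Fin n
unsplit (true  ∷ p) (inj₁ zero)    = zero
unsplit (true  ∷ p) (inj₁ (suc i)) = suc (unsplit p (inj₁ i))
unsplit (true  ∷ p) (inj₂ j)       = suc (unsplit p (inj₂ j))
unsplit (false ∷ p) (inj₁ i)       = suc (unsplit p (inj₁ i))
unsplit (false ∷ p) (inj₂ zero)    = zero
unsplit (false ∷ p) (inj₂ (suc j)) = suc (unsplit p (inj₂ j))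

private
  unsplit-map₁ : ∀ (p : Subset n) r → unsplit (true ∷ p) (Sum.map₁ suc r) ≡ suc (unsplit p r)
  unsplit-map₁ p (inj₁ _) = refl
  unsplit-map₁ p (inj₂ _) = refl

  unsplit-map₂ : ∀ (p : Subset n) r → unsplit (false ∷ p) (Sum.map₂ suc r) ≡ suc (unsplit p r)
  unsplit-map₂ p (inj₁ _) = refl
  unsplit-map₂ p (inj₂ _) = refl

unsplit-split : ∀ (p : Subset n) x → unsplit p (split p x) ≡ x
unsplit-split (true  ∷ p) zero    = refl
unsplit-split (false ∷ p) zero    = refl
unsplit-split (true  ∷ p) (suc x) = trans (unsplit-map₁ p (split p x)) (cong suc (unsplit-split p x))
unsplit-split (false ∷ p) (suc x) = trans (unsplit-map₂ p (split p x)) (cong suc (unsplit-split p x))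

split-unsplit : ∀ (p : Subset n) r → split p (unsplit p r) ≡ r
split-unsplit (true  ∷ p) (inj₁ zero)    = refl
split-unsplit (true  ∷ p) (inj₁ (suc i)) = cong (Sum.map₁ suc) (split-unsplit p (inj₁ i))
split-unsplit (true  ∷ p) (inj₂ j)       = cong (Sum.map₁ suc) (split-unsplit p (inj₂ j))
split-unsplit (false ∷ p) (inj₁ i)       = cong (Sum.map₂ suc) (split-unsplit p (inj₁ i))
split-unsplit (false ∷ p) (inj₂ zero)    = refl
split-unsplit (false ∷ p) (inj₂ (suc j)) = cong (Sum.map₂ suc) (split-unsplit p (inj₂ j))

unsplit-inj₂∉ : ∀ (p : Subset n) j → unsplit p (inj₂ j) ∉ p
unsplit-inj₂∉ (true  ∷ p) j       (there x∈p) = unsplit-inj₂∉ p j x∈p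
unsplit-inj₂∉ (false ∷ p) zero    ()
unsplit-inj₂∉ (false ∷ p) (suc j) (there x∈p) = unsplit-inj₂∉ p j x∈p

split↔ : ∀ (p : Subset n) {a b} → ∣ p ∣ ≡ a → ∣ ∁ p ∣ ≡ b →
         Σ (Fin n ↔ (Fin a ⊎ Fin b)) λ e → ∀ j → Inverse.from e (inj₂ j) ∉ p
split↔ p refl refl = mk↔ₛ′ (split p) (unsplit p) (split-unsplit p) (unsplit-split p) , unsplit-inj₂∉ p

-- Steiner quasigroups

record SteinerQuasigroup (A : Set) : Set where
  infixl 7 _·_
  field
    _·_    : A → A → A
    idem   : ∀ x → x · x ≡ x
    comm   : ∀ x y → x · y ≡ y · x
    cancel : ∀ x y → x · (x · y) ≡ y

  cancel′ : ∀ x y → x · (y · x) ≡ y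
  cancel′ x y = trans (cong (x ·_) (comm y x)) (cancel x y)

  ·≢ˡ : ∀ {x y} → x ≢ y → x · y ≢ x
  ·≢ˡ {x} {y} x≢y xy≡x = x≢y (begin
    x            ≡⟨ idem x ⟨
    x · x        ≡⟨ cong (x ·_) xy≡x ⟨
    x · (x · y)  ≡⟨ cancel x y ⟩
    y            ∎)
    where open ≡-Reasoning

  ·≢ʳ : ∀ {x y} → x ≢ y → x · y ≢ y
  ·≢ʳ {x} {y} x≢y xy≡y = ·≢ˡ (≢-sym x≢y) (trans (comm y x) xy≡y)

module _ {A : Set} (_·_ : A → A → A) where

  ProductOf : (A → Set) → A → Set
  ProductOf P z = ∃₂ λ x y → x ≢ y × P x × P y × x · y ≡ z

  ProductFree : (A → Set) → Set
  ProductFree P = ∀ {x y} → x ≢ y → P x → P y → ¬ P (x · y)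

  Saturated : (A → Set) → Set
  Saturated P = ∀ z → ¬ P z → ProductOf P z

module _ {A : Set} (Q : SteinerQuasigroup A) where
  open SteinerQuasigroup Q

  productFree-⊆ : ∀ {P P′ : A → Set} → (∀ {x} → P′ x → P x) → ProductFree _·_ P → ProductFree _·_ P′
  productFree-⊆ P′⊆P P-free x≢y P′x P′y P′xy = P-free x≢y (P′⊆P P′x) (P′⊆P P′y) (P′⊆P P′xy)

  productFree-∪ : ∀ {P : A → Set} {z} → ProductFree _·_ P → ¬ ProductOf _·_ P z →
                  ProductFree _·_ (λ w → P w ⊎ w ≡ z)
  productFree-∪ P-free ¬z-product x≢y (inj₁ Px) (inj₁ Py) (inj₁ Pxy) = P-free x≢y Px Py Pxy
  productFree-∪ P-free ¬z-product {x} {y} x≢y (inj₁ Px) (inj₁ Py) (inj₂ xy≡z) =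
    ¬z-product (x , y , x≢y , Px , Py , xy≡z)
  productFree-∪ P-free ¬z-product {x} {y} x≢y (inj₁ Px) (inj₂ refl) (inj₁ Pxy) =
    ¬z-product (x , x · y , ≢-sym (·≢ˡ x≢y) , Px , Pxy , cancel x y)
  productFree-∪ P-free ¬z-product {x} {y} x≢y (inj₂ refl) (inj₁ Py) (inj₁ Pxy) =
    ¬z-product (y , x · y , ≢-sym (·≢ʳ x≢y) , Py , Pxy , cancel′ y x)
  productFree-∪ P-free ¬z-product x≢y (inj₁ Px)   (inj₂ refl) (inj₂ xy≡y) = ·≢ʳ x≢y xy≡y
  productFree-∪ P-free ¬z-product x≢y (inj₂ refl) (inj₁ Py)   (inj₂ xy≡x) = ·≢ˡ x≢y xy≡x
  productFree-∪ P-free ¬z-product x≢y (inj₂ refl) (inj₂ refl) _           = x≢y refl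

Triangle : (Fin n → Fin n → Fin n) → Subset n → Set
Triangle _·_ B = ∃₂ λ x y → x ≢ y × B ≡ ⟨ x , y , x · y ⟩

TriangulatedBy : STS n → (Fin n → Fin n → Fin n) → Set
TriangulatedBy S _·_ = ∀ B → IsBlock S B ⇔ Triangle _·_ B

module TriangleSystem (Q : SteinerQuasigroup (Fin n)) where
  open SteinerQuasigroup Q

  ∣triangle∣≡3 : ∀ {x y} → x ≢ y → ∣ ⟨ x , y , x · y ⟩ ∣ ≡ 3
  ∣triangle∣≡3 x≢y = ∣⟨⟩∣≡3 x≢y (≢-sym (·≢ˡ x≢y)) (≢-sym (·≢ʳ x≢y))

  private
    ≡∈ : ∀ {z w} {B : Subset n} → z ≡ w → w ∈ B → z ∈ B
    ≡∈ refl w∈B = w∈B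

  triangle-closed : ∀ {a b x y} → a ≢ b → x ≢ y →
                    x ∈ ⟨ a , b , a · b ⟩ → y ∈ ⟨ a , b , a · b ⟩ → x · y ∈ ⟨ a , b , a · b ⟩
  triangle-closed {a} {b} a≢b x≢y x∈ y∈ with ∈⟨⟩⁻ x∈ | ∈⟨⟩⁻ y∈
  ... | inj₁ refl        | inj₁ refl        = contradiction refl x≢y
  ... | inj₁ refl        | inj₂ (inj₁ refl) = c∈⟨⟩
  ... | inj₁ refl        | inj₂ (inj₂ refl) = ≡∈ (cancel a b) b∈⟨⟩
  ... | inj₂ (inj₁ refl) | inj₁ refl        = ≡∈ (comm b a) c∈⟨⟩
  ... | inj₂ (inj₁ refl) | inj₂ (inj₁ refl) = contradiction refl x≢y
  ... | inj₂ (inj₁ refl) | inj₂ (inj₂ refl) = ≡∈ (cancel′ b a) a∈⟨⟩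
  ... | inj₂ (inj₂ refl) | inj₁ refl        = ≡∈ (trans (comm (a · b) a) (cancel a b)) b∈⟨⟩
  ... | inj₂ (inj₂ refl) | inj₂ (inj₁ refl) = ≡∈ (trans (comm (a · b) b) (cancel′ b a)) a∈⟨⟩
  ... | inj₂ (inj₂ refl) | inj₂ (inj₂ refl) = contradiction refl x≢y

  triangle-unique : ∀ {a b x y} → a ≢ b → x ≢ y →
                    x ∈ ⟨ a , b , a · b ⟩ → y ∈ ⟨ a , b , a · b ⟩ → ⟨ x , y , x · y ⟩ ≡ ⟨ a , b , a · b ⟩
  triangle-unique a≢b x≢y x∈ y∈ =
    sym (∣B∣≡3⇒B≡⟨⟩ (∣triangle∣≡3 a≢b) x∈ y∈ (triangle-closed a≢b x≢y x∈ y∈)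
                    x≢y (≢-sym (·≢ˡ x≢y)) (≢-sym (·≢ʳ x≢y)))

  triangleSystem : STS n
  triangleSystem = record
    { IsBlock     = Triangle _·_
    ; block-size  = λ { _ (_ , _ , x≢y , refl) → ∣triangle∣≡3 x≢y }
    ; pair-unique = λ x y x≢y →
        ⟨ x , y , x · y ⟩ , ((x , y , x≢y , refl) , a∈⟨⟩ , b∈⟨⟩) ,
        λ { ((_ , _ , a≢b , refl) , x∈ , y∈) → triangle-unique a≢b x≢y x∈ y∈ }
    }

  triangleSystem-triangulated : TriangulatedBy triangleSystem _·_
  triangleSystem-triangulated _ = mk⇔ id id

module BlockProduct (S : STS n) where

  private
    through : ∀ {x y : Fin n} → x ≢ y → Σ (Subset n) λ B → IsBlock S B × x ∈ B × y ∈ B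
    through {x} {y} x≢y = proj₁ (pair-unique S x y x≢y) , proj₁ (proj₂ (pair-unique S x y x≢y))

    through-unique : ∀ {x y : Fin n} {B B′} → x ≢ y →
                     IsBlock S B → x ∈ B → y ∈ B → IsBlock S B′ → x ∈ B′ → y ∈ B′ → B ≡ B′
    through-unique {x} {y} x≢y B-block x∈B y∈B B′-block x∈B′ y∈B′ =
      trans (sym (unique (B-block , x∈B , y∈B))) (unique (B′-block , x∈B′ , y∈B′))
      where
      unique : ∀ {B″} → IsBlock S B″ × x ∈ B″ × y ∈ B″ → proj₁ (pair-unique S x y x≢y) ≡ B″
      unique = proj₂ (proj₂ (pair-unique S x y x≢y))

    outside : ∀ {B p} → IsBlock S B → ∣ p ∣ < 3 → ∃ λ x → x ∈ B × x ∉ p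
    outside {B} B-block ∣p∣<3 = ∣p∣<∣q∣⇒∃∈q∉p (subst (_ <_) (sym (block-size S B B-block)) ∣p∣<3)

    ∣x,y∣<3 : ∀ {x y : Fin n} → x ≢ y → ∣ ⁅ x ⁆ ∪ ⁅ y ⁆ ∣ < 3
    ∣x,y∣<3 {y = y} x≢y =
      subst (_< 3) (sym (trans (∣⁅x⁆∪p∣≡1+∣p∣ (x≢y⇒x∉⁅y⁆ x≢y)) (cong suc (∣⁅x⁆∣≡1 y)))) (n<1+n 2)

    third : ∀ {x y : Fin n} (x≢y : x ≢ y) → ∃ λ z → z ∈ proj₁ (through x≢y) × z ∉ ⁅ x ⁆ ∪ ⁅ y ⁆
    third x≢y = outside (proj₁ (proj₂ (through x≢y))) (∣x,y∣<3 x≢y)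

    product : ∀ x y → Dec (x ≡ y) → Fin n
    product x _ (yes _)  = x
    product _ _ (no x≢y) = proj₁ (third x≢y)

  infixl 7 _·_
  _·_ : Fin n → Fin n → Fin n
  x · y = product x y (x ≟ᶠ y)

  ·-block : ∀ {x y} → x ≢ y →
            Σ (Subset n) λ B → IsBlock S B × x ∈ B × y ∈ B × x · y ∈ B × x · y ≢ x × x · y ≢ y
  ·-block {x} {y} x≢y with x ≟ᶠ y
  ... | yes x≡y = contradiction x≡y x≢y
  ... | no x≢y′ =
    B , B-block , x∈B , y∈B , z∈B ,
    (λ z≡x → z∉xy (x∈p∪q⁺ (inj₁ (Equivalence.from x∈⁅y⁆⇔x≡y z≡x)))) ,
    (λ z≡y → z∉xy (x∈p∪q⁺ (inj₂ (Equivalence.from x∈⁅y⁆⇔x≡y z≡y))))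
    where
    B : Subset n
    B = proj₁ (through x≢y′)
    B-block : IsBlock S B
    B-block = proj₁ (proj₂ (through x≢y′))
    x∈B : x ∈ B
    x∈B = proj₁ (proj₂ (proj₂ (through x≢y′)))
    y∈B : y ∈ B
    y∈B = proj₂ (proj₂ (proj₂ (through x≢y′)))
    z∈B : proj₁ (third x≢y′) ∈ B
    z∈B = proj₁ (proj₂ (third x≢y′))
    z∉xy : proj₁ (third x≢y′) ∉ ⁅ x ⁆ ∪ ⁅ y ⁆
    z∉xy = proj₂ (proj₂ (third x≢y′))

  block≡⟨⟩ : ∀ {B x y} → IsBlock S B → x ∈ B → y ∈ B → x ≢ y → B ≡ ⟨ x , y , x · y ⟩
  block≡⟨⟩ {B} B-block x∈B y∈B x≢y with ·-block x≢y
  ... | B′ , B′-block , x∈B′ , y∈B′ , xy∈B′ , xy≢x , xy≢y =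
    ∣B∣≡3⇒B≡⟨⟩ (block-size S B B-block) x∈B y∈B xy∈B x≢y (≢-sym xy≢x) (≢-sym xy≢y)
    where
    xy∈B : _ ∈ B
    xy∈B = subst (_ ∈_) (through-unique x≢y B′-block x∈B′ y∈B′ B-block x∈B y∈B) xy∈B′

  ·-third : ∀ {B x y z} → IsBlock S B → x ∈ B → y ∈ B → z ∈ B → x ≢ y → z ≢ x → z ≢ y → x · y ≡ z
  ·-third B-block x∈B y∈B z∈B x≢y z≢x z≢y
    with ∈⟨⟩⁻ (subst (_ ∈_) (block≡⟨⟩ B-block x∈B y∈B x≢y) z∈B)
  ... | inj₁ z≡x         = contradiction z≡x z≢x
  ... | inj₂ (inj₁ z≡y)  = contradiction z≡y z≢y
  ... | inj₂ (inj₂ z≡xy) = sym z≡xy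

  ·-idem : ∀ x → x · x ≡ x
  ·-idem x with x ≟ᶠ x
  ... | yes _  = refl
  ... | no x≢x = contradiction refl x≢x

  ·-comm : ∀ x y → x · y ≡ y · x
  ·-comm x y = by-cases (x ≟ᶠ y)
    where
    by-cases : Dec (x ≡ y) → x · y ≡ y · x
    by-cases (yes refl) = refl
    by-cases (no x≢y) with ·-block x≢y
    ... | _ , B-block , x∈B , y∈B , xy∈B , xy≢x , xy≢y =
      sym (·-third B-block y∈B x∈B xy∈B (≢-sym x≢y) xy≢y xy≢x)

  ·-cancel : ∀ x y → x · (x · y) ≡ y
  ·-cancel x y = by-cases (x ≟ᶠ y)
    where
    by-cases : Dec (x ≡ y) → x · (x · y) ≡ y
    by-cases (yes refl) = trans (cong (x ·_) (·-idem x)) (·-idem x)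
    by-cases (no x≢y) with ·-block x≢y
    ... | _ , B-block , x∈B , y∈B , xy∈B , xy≢x , xy≢y =
      ·-third B-block x∈B xy∈B y∈B (≢-sym xy≢x) (≢-sym x≢y) (≢-sym xy≢y)

  blockQuasigroup : SteinerQuasigroup (Fin n)
  blockQuasigroup = record { _·_ = _·_ ; idem = ·-idem ; comm = ·-comm ; cancel = ·-cancel }

  blockQuasigroup-triangulated : TriangulatedBy S _·_
  blockQuasigroup-triangulated B = mk⇔ block⇒triangle triangle⇒block
    where
    block⇒triangle : IsBlock S B → Triangle _·_ B
    block⇒triangle B-block with outside {p = ⊥} B-block (subst (_< 3) (sym (∣⊥∣≡0 n)) (s≤s z≤n))
    ... | x , x∈B , _ with outside {p = ⁅ x ⁆} B-block (subst (_< 3) (sym (∣⁅x⁆∣≡1 x)) (s≤s (s≤s z≤n)))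
    ...   | y , y∈B , y∉x = x , y , x≢y , block≡⟨⟩ B-block x∈B y∈B x≢y
      where
      x≢y : x ≢ y
      x≢y = ≢-sym (x∉⁅y⁆⇒x≢y y∉x)

    triangle⇒block : Triangle _·_ B → IsBlock S B
    triangle⇒block (x , y , x≢y , refl) with ·-block x≢y
    ... | B′ , B′-block , x∈B′ , y∈B′ , _ = subst (IsBlock S) (block≡⟨⟩ B′-block x∈B′ y∈B′ x≢y) B′-block

module Triangulated (S : STS n) (Q : SteinerQuasigroup (Fin n))
                    (S-triangulated : TriangulatedBy S (SteinerQuasigroup._·_ Q)) where
  open SteinerQuasigroup Q

  independent⇔productFree : ∀ {T} → Independent S T ⇔ ProductFree _·_ (_∈ T)
  independent⇔productFree {T} = mk⇔ to from
    where
    to : Independent S T → ProductFree _·_ (_∈ T)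
    to T-independent {x} {y} x≢y x∈T y∈T xy∈T =
      T-independent _ (Equivalence.from (S-triangulated _) (x , y , x≢y , refl)) (⟨⟩⊆ x∈T y∈T xy∈T)

    from : ProductFree _·_ (_∈ T) → Independent S T
    from T-free B B-block B⊆T with Equivalence.to (S-triangulated B) B-block
    ... | x , y , x≢y , refl = T-free x≢y (B⊆T a∈⟨⟩) (B⊆T b∈⟨⟩) (B⊆T c∈⟨⟩)

  productOf? : ∀ T z → Dec (ProductOf _·_ (_∈ T) z)
  productOf? T z = any? λ x → any? λ y → ¬? (x ≟ᶠ y) ×-dec x ∈? T ×-dec y ∈? T ×-dec x · y ≟ᶠ z

  maximal⇔saturated : ∀ {T} → MaximalIndependent S T ⇔ (ProductFree _·_ (_∈ T) × Saturated _·_ (_∈ T))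
  maximal⇔saturated {T} = mk⇔ to from
    where
    to : MaximalIndependent S T → ProductFree _·_ (_∈ T) × Saturated _·_ (_∈ T)
    to (T-independent , T-maximal) = T-free , saturated
      where
      T-free : ProductFree _·_ (_∈ T)
      T-free = Equivalence.to independent⇔productFree T-independent

      saturated : Saturated _·_ (_∈ T)
      saturated z z∉T with productOf? T z
      ... | yes z-product = z-product
      ... | no ¬z-product =
        contradiction (T-maximal (T ∪ ⁅ z ⁆) T∪z-independent (x∈p∪q⁺ ∘′ inj₁) (x∈p∪q⁺ (inj₂ (x∈⁅x⁆ z))))
                      z∉T
        where
        T∪z-independent : Independent S (T ∪ ⁅ z ⁆)
        T∪z-independent = Equivalence.from independent⇔productFree
          (productFree-⊆ Q (Sum.map₂ (x∈⁅y⁆⇒x≡y z) ∘′ x∈p∪q⁻ T _) (productFree-∪ Q T-free ¬z-product))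

    from : ProductFree _·_ (_∈ T) × Saturated _·_ (_∈ T) → MaximalIndependent S T
    from (T-free , saturated) = Equivalence.from independent⇔productFree T-free , maximal
      where
      maximal : ∀ U → Independent S U → T ⊆ U → U ⊆ T
      maximal U U-independent T⊆U {z} z∈U with z ∈? T
      ... | yes z∈T = z∈T
      ... | no z∉T with saturated z z∉T
      ...   | x , y , x≢y , x∈T , y∈T , refl =
        contradiction z∈U (Equivalence.to independent⇔productFree U-independent x≢y (T⊆U x∈T) (T⊆U y∈T))

homomorphism⇒embedding :
  ∀ {m} {S : STS m} {S′ : STS n} {_·_ : Fin m → Fin m → Fin m} {_·′_ : Fin n → Fin n → Fin n} →
  TriangulatedBy S _·_ → TriangulatedBy S′ _·′_ →
  (f : Fin m → Fin n) → Injective _≡_ _≡_ f → (∀ x y → f (x · y) ≡ f x ·′ f y) → IsEmbedding S S′ f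
homomorphism⇒embedding {n = n} {S = S} {S′} {_·_} S-triangulated S′-triangulated f f-injective f-hom =
  f-injective , image
  where
  image : ∀ B → IsBlock S B →
          Σ (Subset n) λ B′ → IsBlock S′ B′ × (∀ w → w ∈ B′ ⇔ ∃ λ x → x ∈ B × f x ≡ w)
  image B B-block with Equivalence.to (S-triangulated B) B-block
  ... | x , y , x≢y , refl = ⟨ f x , f y , f (x · y) ⟩ , image-block , λ w → mk⇔ (preimage w) (∈image w)
    where
    image-block : IsBlock S′ ⟨ f x , f y , f (x · y) ⟩
    image-block = Equivalence.from (S′-triangulated _)
      (f x , f y , x≢y ∘′ f-injective , cong (λ z → ⟨ f x , f y , z ⟩) (f-hom x y))

    preimage : ∀ w → w ∈ ⟨ f x , f y , f (x · y) ⟩ → ∃ λ x′ → x′ ∈ ⟨ x , y , x · y ⟩ × f x′ ≡ w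
    preimage w w∈ with ∈⟨⟩⁻ w∈
    ... | inj₁ refl        = x , a∈⟨⟩ , refl
    ... | inj₂ (inj₁ refl) = y , b∈⟨⟩ , refl
    ... | inj₂ (inj₂ refl) = x · y , c∈⟨⟩ , refl

    ∈image : ∀ w → (∃ λ x′ → x′ ∈ ⟨ x , y , x · y ⟩ × f x′ ≡ w) → w ∈ ⟨ f x , f y , f (x · y) ⟩
    ∈image w (x′ , x′∈ , refl) = ∈⟨⟩⁺ (Sum.map (cong f) (Sum.map (cong f) (cong f)) (∈⟨⟩⁻ x′∈))

module Transport {A B : Set} (Q : SteinerQuasigroup A) (e : A ↔ B) where
  open SteinerQuasigroup Q
  open Inverse e using (to; from; strictlyInverseˡ; strictlyInverseʳ)

  infixl 7 _·′_
  _·′_ : B → B → B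
  i ·′ j = to (from i · from j)

  transported : SteinerQuasigroup B
  transported = record
    { _·_    = _·′_
    ; idem   = λ i → trans (cong to (idem (from i))) (strictlyInverseˡ i)
    ; comm   = λ i j → cong to (comm (from i) (from j))
    ; cancel = λ i j → begin
        to (from i · from (to (from i · from j)))  ≡⟨ cong (λ a → to (from i · a)) (strictlyInverseʳ _) ⟩
        to (from i · (from i · from j))            ≡⟨ cong to (cancel (from i) (from j)) ⟩
        to (from j)                                ≡⟨ strictlyInverseˡ j ⟩
        j                                          ∎
    }
    where open ≡-Reasoning

  to-homomorphic : ∀ x y → to (x · y) ≡ to x ·′ to y
  to-homomorphic x y = cong to (cong₂ _·_ (sym (strictlyInverseʳ x)) (sym (strictlyInverseʳ y)))

  to-injective : Injective _≡_ _≡_ to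
  to-injective = Injection.injective (↔⇒↣ e)

  from-injective : Injective _≡_ _≡_ from
  from-injective = Injection.injective (↔⇒↣ (↔-sym e))

  module _ {P : A → Set} {P′ : B → Set} (P′∘to⇔P : ∀ a → P′ (to a) ⇔ P a) where

    private
      P′⇒P∘from : ∀ {i} → P′ i → P (from i)
      P′⇒P∘from {i} P′i = Equivalence.to (P′∘to⇔P (from i)) (subst P′ (sym (strictlyInverseˡ i)) P′i)

      P∘from⇒P′ : ∀ {i} → P (from i) → P′ i
      P∘from⇒P′ {i} Pfi = subst P′ (strictlyInverseˡ i) (Equivalence.from (P′∘to⇔P (from i)) Pfi)

    productFree-transport : ProductFree _·_ P → ProductFree _·′_ P′
    productFree-transport P-free i≢j P′i P′j P′ij =
      P-free (i≢j ∘′ from-injective) (P′⇒P∘from P′i) (P′⇒P∘from P′j)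
        (subst P (strictlyInverseʳ _) (P′⇒P∘from P′ij))

    saturated-transport : Saturated _·_ P → Saturated _·′_ P′
    saturated-transport P-saturated i ¬P′i with P-saturated (from i) (¬P′i ∘′ P∘from⇒P′)
    ... | x , y , x≢y , Px , Py , xy≡fi =
      to x , to y , x≢y ∘′ to-injective ,
      Equivalence.from (P′∘to⇔P x) Px , Equivalence.from (P′∘to⇔P y) Py ,
      trans (sym (to-homomorphic x y)) (trans (cong to xy≡fi) (strictlyInverseˡ i))

-- The doubling construction

-- Two points of Y whose sum is the label of x ∈ X multiply to x; on the remaining pairs of distinct
-- points of Y, _∘_ has to be a partial Steiner quasigroup.
module Doubling
  {X Y : Set} (Q : SteinerQuasigroup X) (_≟ʸ_ : DecidableEquality Y)
  (_⊕_ : Y → Y → Y) (⊕-comm : ∀ y z → y ⊕ z ≡ z ⊕ y) (⊕-cancel : ∀ y z → y ⊕ (y ⊕ z) ≡ z)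
  (label : X → Y) (unlabel : Y → Maybe X)
  (unlabel-label : ∀ x → unlabel (label x) ≡ just x)
  (label-unlabel : ∀ {d x} → unlabel d ≡ just x → label x ≡ d)
  (unlabel-self : ∀ y → unlabel (y ⊕ y) ≡ nothing)
  (_∘_ : Y → Y → Y)
  (∘-comm   : ∀ {y z} → y ≢ z → unlabel (y ⊕ z) ≡ nothing → y ∘ z ≡ z ∘ y)
  (∘-local  : ∀ {y z} → y ≢ z → unlabel (y ⊕ z) ≡ nothing → y ≢ y ∘ z × unlabel (y ⊕ (y ∘ z)) ≡ nothing)
  (∘-cancel : ∀ {y z} → y ≢ z → unlabel (y ⊕ z) ≡ nothing → y ∘ (y ∘ z) ≡ z)
  where

  open SteinerQuasigroup Q

  ⊕-cancelʳ : ∀ y z → (y ⊕ z) ⊕ z ≡ y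
  ⊕-cancelʳ y z = trans (⊕-comm (y ⊕ z) z) (trans (cong (z ⊕_) (⊕-comm y z)) (⊕-cancel z y))

  across : Y → Y → Maybe X → X ⊎ Y
  across _ _ (just x) = inj₁ x
  across y z nothing  = inj₂ (y ∘ z)

  infixl 7 _⋆_
  _⋆_ : X ⊎ Y → X ⊎ Y → X ⊎ Y
  inj₁ x ⋆ inj₁ x′ = inj₁ (x · x′)
  inj₁ x ⋆ inj₂ y  = inj₂ (y ⊕ label x)
  inj₂ y ⋆ inj₁ x  = inj₂ (y ⊕ label x)
  inj₂ y ⋆ inj₂ z  = if does (y ≟ʸ z) then inj₂ y else across y z (unlabel (y ⊕ z))

  ⋆-idemʸ : ∀ y → inj₂ y ⋆ inj₂ y ≡ inj₂ y
  ⋆-idemʸ y with y ≟ʸ y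
  ... | yes _  = refl
  ... | no y≢y = contradiction refl y≢y

  ⋆-across : ∀ {y z} → y ≢ z → inj₂ y ⋆ inj₂ z ≡ across y z (unlabel (y ⊕ z))
  ⋆-across {y} {z} y≢z with y ≟ʸ z
  ... | yes y≡z = contradiction y≡z y≢z
  ... | no _    = refl

  ⋆-idem : ∀ a → a ⋆ a ≡ a
  ⋆-idem (inj₁ x) = cong inj₁ (idem x)
  ⋆-idem (inj₂ y) = ⋆-idemʸ y

  ⋆-comm : ∀ a b → a ⋆ b ≡ b ⋆ a
  ⋆-comm (inj₁ x) (inj₁ x′) = cong inj₁ (comm x x′)
  ⋆-comm (inj₁ x) (inj₂ y)  = refl
  ⋆-comm (inj₂ y) (inj₁ x)  = refl
  ⋆-comm (inj₂ y) (inj₂ z) with y ≟ʸ z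
  ... | yes refl = sym (⋆-idemʸ y)
  ... | no y≢z   = begin
    across y z (unlabel (y ⊕ z))  ≡⟨ across-comm (unlabel (y ⊕ z)) refl ⟩
    across z y (unlabel (y ⊕ z))  ≡⟨ cong (across z y ∘′ unlabel) (⊕-comm y z) ⟩
    across z y (unlabel (z ⊕ y))  ≡⟨ ⋆-across (≢-sym y≢z) ⟨
    inj₂ z ⋆ inj₂ y               ∎
    where
    open ≡-Reasoning
    across-comm : ∀ m → unlabel (y ⊕ z) ≡ m → across y z m ≡ across z y m
    across-comm (just _) _        = refl
    across-comm nothing  yz-local = cong inj₂ (∘-comm y≢z yz-local)

  ⋆-cancel : ∀ a b → a ⋆ (a ⋆ b) ≡ b
  ⋆-cancel (inj₁ x) (inj₁ x′) = cong inj₁ (cancel x x′)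
  ⋆-cancel (inj₁ x) (inj₂ y)  = cong inj₂ (⊕-cancelʳ y (label x))
  ⋆-cancel (inj₂ y) (inj₁ x)  = begin
    inj₂ y ⋆ inj₂ (y ⊕ label x)                           ≡⟨ ⋆-across y≢y⊕x ⟩
    across y (y ⊕ label x) (unlabel (y ⊕ (y ⊕ label x)))
      ≡⟨ cong (across y _ ∘′ unlabel) (⊕-cancel y (label x)) ⟩
    across y (y ⊕ label x) (unlabel (label x))            ≡⟨ cong (across y _) (unlabel-label x) ⟩
    inj₁ x                                                ∎
    where
    open ≡-Reasoning
    y≢y⊕x : y ≢ y ⊕ label x
    y≢y⊕x y≡y⊕x = contradiction (begin
      nothing                       ≡⟨ unlabel-self y ⟨
      unlabel (y ⊕ y)               ≡⟨ cong (λ d → unlabel (y ⊕ d)) y≡y⊕x ⟩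
      unlabel (y ⊕ (y ⊕ label x))   ≡⟨ cong unlabel (⊕-cancel y (label x)) ⟩
      unlabel (label x)             ≡⟨ unlabel-label x ⟩
      just x                        ∎) λ ()
  ⋆-cancel (inj₂ y) (inj₂ z) with y ≟ʸ z
  ... | yes refl = ⋆-idemʸ y
  ... | no y≢z   = cancel-across (unlabel (y ⊕ z)) refl
    where
    cancel-across : ∀ m → unlabel (y ⊕ z) ≡ m → inj₂ y ⋆ across y z m ≡ inj₂ z
    cancel-across (just x) yz↦x = cong inj₂ (trans (cong (y ⊕_) (label-unlabel yz↦x)) (⊕-cancel y z))
    cancel-across nothing yz-local with ∘-local y≢z yz-local
    ... | y≢y∘z , y,y∘z-local =
      trans (⋆-across y≢y∘z) (trans (cong (across y _) y,y∘z-local) (cong inj₂ (∘-cancel y≢z yz-local)))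

  doubled : SteinerQuasigroup (X ⊎ Y)
  doubled = record { _·_ = _⋆_ ; idem = ⋆-idem ; comm = ⋆-comm ; cancel = ⋆-cancel }

  module _ (β : Y → Bool) (β-⊕ : ∀ y z → β (y ⊕ z) ≡ β y xor β z)
           {T : X → Set} (β-label : ∀ {x} → T x → β (label x) ≡ true)
           (∘-odd : ∀ {y z} → y ≢ z → unlabel (y ⊕ z) ≡ nothing →
                    β y ≡ false → β z ≡ false → β (y ∘ z) ≡ true)
           where

    T⁺ : X ⊎ Y → Set
    T⁺ = [ T , (λ y → β y ≡ false) ]′

    private
      true≢false : ∀ {b} → b ≡ true → b ≢ false
      true≢false refl ()

      β-even : ∀ {y z} → β y ≡ false → β z ≡ false → β (y ⊕ z) ≡ false
      β-even {y} {z} βy βz = trans (β-⊕ y z) (cong₂ _xor_ βy βz)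

      β-odd : ∀ {y x} → β y ≡ false → T x → β (y ⊕ label x) ≡ true
      β-odd {y} {x} βy Tx = trans (β-⊕ y (label x)) (cong₂ _xor_ βy (β-label Tx))

    productFree-doubled : ProductFree _·_ T → ProductFree _⋆_ T⁺
    productFree-doubled T-free {inj₁ _} {inj₁ _} x≢x′ Tx Tx′ Txx′ = T-free (x≢x′ ∘′ cong inj₁) Tx Tx′ Txx′
    productFree-doubled T-free {inj₁ _} {inj₂ _} _ Tx βy βy⊕x     = true≢false (β-odd βy Tx) βy⊕x
    productFree-doubled T-free {inj₂ _} {inj₁ _} _ βy Tx βy⊕x     = true≢false (β-odd βy Tx) βy⊕x
    productFree-doubled T-free {inj₂ y} {inj₂ z} y≢z βy βz T⁺yz =
      across-odd (unlabel (y ⊕ z)) refl (subst T⁺ (⋆-across y≢z′) T⁺yz)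
      where
      y≢z′ : y ≢ z
      y≢z′ = y≢z ∘′ cong inj₂
      across-odd : ∀ m → unlabel (y ⊕ z) ≡ m → ¬ T⁺ (across y z m)
      across-odd (just x) yz↦x Tx =
        true≢false (β-label Tx) (trans (cong β (label-unlabel yz↦x)) (β-even βy βz))
      across-odd nothing yz-local βy∘z = true≢false (∘-odd y≢z′ yz-local βy βz) βy∘z

    saturated-doubled : Saturated _·_ T → ∀ {t₀} → T t₀ → Saturated _⋆_ T⁺
    saturated-doubled T-saturated _ (inj₁ x) ¬Tx with T-saturated x ¬Tx
    ... | a , b , a≢b , Ta , Tb , ab≡x =
      inj₁ a , inj₁ b , a≢b ∘′ inj₁-injective , Ta , Tb , cong inj₁ ab≡x
    saturated-doubled _ {t₀} Tt₀ (inj₂ y) βy≢false =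
      inj₁ t₀ , inj₂ (y ⊕ label t₀) , (λ ()) , Tt₀ ,
      trans (β-⊕ y (label t₀)) (cong₂ _xor_ (¬-not βy≢false) (β-label Tt₀)) ,
      cong inj₂ (⊕-cancelʳ y (label t₀))

-- Boolean vectors and the local triangles

infixl 6 _⊕_
_⊕_ : ∀ {m} → Vec Bool m → Vec Bool m → Vec Bool m
_⊕_ = zipWith _xor_

zeros : ∀ {m} → Vec Bool m
zeros = replicate _ false

⊕-comm : ∀ {m} (u w : Vec Bool m) → u ⊕ w ≡ w ⊕ u
⊕-comm = zipWith-comm xor-comm

⊕-cancel : ∀ {m} (u w : Vec Bool m) → u ⊕ (u ⊕ w) ≡ w
⊕-cancel []      []      = refl
⊕-cancel (a ∷ u) (b ∷ w) =
  cong₂ _∷_ (trans (sym (xor-assoc a a b)) (cong (_xor b) (xor-same a))) (⊕-cancel u w)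

⊕-self : ∀ {m} (u : Vec Bool m) → u ⊕ u ≡ zeros
⊕-self []      = refl
⊕-self (a ∷ u) = cong₂ _∷_ (xor-same a) (⊕-self u)

⊕≡zeros⇒≡ : ∀ {m} {u w : Vec Bool m} → u ⊕ w ≡ zeros → u ≡ w
⊕≡zeros⇒≡ {u = u} {w} u⊕w≡0 = begin
  u            ≡⟨ zipWith-identityʳ xor-identityʳ u ⟨
  u ⊕ zeros    ≡⟨ cong (u ⊕_) u⊕w≡0 ⟨
  u ⊕ (u ⊕ w)  ≡⟨ ⊕-cancel u w ⟩
  w            ∎
  where open ≡-Reasoning

∀-Bool? : {P : Bool → Set} → (∀ b → Dec (P b)) → Dec (∀ b → P b)
∀-Bool? P? = map′ (λ { (Pf , Pt) false → Pf ; (Pf , Pt) true → Pt }) (λ ∀P → ∀P false , ∀P true)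
                  (P? false ×-dec P? true)

∀-Bits? : ∀ {m} {P : Vec Bool m → Set} → (∀ w → Dec (P w)) → Dec (∀ w → P w)
∀-Bits? {zero}  P? = map′ (λ P[] → λ { [] → P[] }) (λ ∀P → ∀P []) (P? [])
∀-Bits? {suc m} P? = map′ (λ ∀P → λ { (b ∷ w) → ∀P b w }) (λ ∀P b w → ∀P (b ∷ w))
                          (∀-Bool? λ b → ∀-Bits? λ w → P? (b ∷ w))

Pos : Set
Pos = Vec Bool 3

infix 4 _≟ᵖ_
_≟ᵖ_ : DecidableEquality Pos
_≟ᵖ_ = Vec-≡-dec _≟ᵇ_

private
  pattern O = false
  pattern I = true

c₀ : Pos
c₀ = O ∷ O ∷ I ∷ []

-- A decomposition into triangles of K₈ minus the perfect matching p ↔ p ⊕ c₀.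
localTriangles : List (Pos × Pos × Pos)
localTriangles =
  (O ∷ O ∷ O ∷ [] , O ∷ I ∷ O ∷ [] , I ∷ O ∷ O ∷ []) ∷
  (O ∷ O ∷ O ∷ [] , O ∷ I ∷ I ∷ [] , I ∷ I ∷ O ∷ []) ∷
  (O ∷ O ∷ I ∷ [] , O ∷ I ∷ O ∷ [] , I ∷ I ∷ I ∷ []) ∷
  (O ∷ O ∷ I ∷ [] , O ∷ I ∷ I ∷ [] , I ∷ O ∷ I ∷ []) ∷
  (I ∷ O ∷ O ∷ [] , I ∷ I ∷ O ∷ [] , O ∷ O ∷ I ∷ []) ∷
  (I ∷ O ∷ O ∷ [] , I ∷ I ∷ I ∷ [] , O ∷ I ∷ I ∷ []) ∷
  (I ∷ O ∷ I ∷ [] , I ∷ I ∷ O ∷ [] , O ∷ I ∷ O ∷ []) ∷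
  (I ∷ O ∷ I ∷ [] , I ∷ I ∷ I ∷ [] , O ∷ O ∷ O ∷ []) ∷ []

-- The vertex of a triangle {a, b, c} other than p ≠ q is a ⊕ b ⊕ c ⊕ p ⊕ q.
third : Pos → Pos → Pos
third p q = search localTriangles
  where
  _∈ᵗ_ : Pos → Pos × Pos × Pos → Bool
  r ∈ᵗ (a , b , c) = does (r ≟ᵖ a) ∨ does (r ≟ᵖ b) ∨ does (r ≟ᵖ c)

  search : List (Pos × Pos × Pos) → Pos
  search []                   = p
  search (t@(a , b , c) ∷ ts) = if p ∈ᵗ t ∧ q ∈ᵗ t then a ⊕ b ⊕ c ⊕ p ⊕ q else search ts

Adjacent : Pos → Pos → Set
Adjacent p q = p ≢ q × p ⊕ q ≢ c₀

private
  adjacent? : ∀ p q → Dec (Adjacent p q)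
  adjacent? p q = ¬? (p ≟ᵖ q) ×-dec ¬? (p ⊕ q ≟ᵖ c₀)

  on-adjacent? : {R : Pos → Pos → Set} → (∀ p q → Dec (R p q)) → Dec (∀ p q → Adjacent p q → R p q)
  on-adjacent? R? = ∀-Bits? λ p → ∀-Bits? λ q → adjacent? p q →-dec R? p q

third-comm : ∀ {p q} → Adjacent p q → third p q ≡ third q p
third-comm {p} {q} = from-yes (on-adjacent? λ p q → third p q ≟ᵖ third q p) p q

third-adjacent : ∀ {p q} → Adjacent p q → Adjacent p (third p q)
third-adjacent {p} {q} = from-yes (on-adjacent? λ p q → adjacent? p (third p q)) p q

third-cancel : ∀ {p q} → Adjacent p q → third p (third p q) ≡ q
third-cancel {p} {q} = from-yes (on-adjacent? λ p q → third p (third p q) ≟ᵖ q) p q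

third-odd : ∀ {p q} → Adjacent p q → head p ≡ false → head q ≡ false → head (third p q) ≡ true
third-odd {p} {q} = from-yes (on-adjacent? λ p q →
  head p ≟ᵇ false →-dec head q ≟ᵇ false →-dec head (third p q) ≟ᵇ true) p q

Bool×↔⊎ : ∀ {A : Set} → (Bool × A) ↔ (A ⊎ A)
Bool×↔⊎ = mk↔ₛ′ to [ (false ,_) , (true ,_) ]′ (λ { (inj₁ _) → refl ; (inj₂ _) → refl })
                 (λ { (false , _) → refl ; (true , _) → refl })
  where
  to : ∀ {A : Set} → Bool × A → A ⊎ A
  to (false , a) = inj₁ a
  to (true  , a) = inj₂ a

uncons↔ : ∀ {A : Set} {m} → Vec A (suc m) ↔ (A × Vec A m)
uncons↔ = mk↔ₛ′ uncons (uncurry _∷_) (λ _ → refl) (λ { (_ ∷ _) → refl })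

-- 2 ^ m ∸ 1, in the form that makes Fin (suc (mersenne (suc m))) literally Fin (suc M + suc M).
mersenne : ℕ → ℕ
mersenne zero    = 0
mersenne (suc m) = mersenne m + suc (mersenne m)

2^m≡1+mersenne : ∀ m → 2 ^ m ≡ suc (mersenne m)
2^m≡1+mersenne zero    = refl
2^m≡1+mersenne (suc m) = trans (cong (2 *_) (2^m≡1+mersenne m))
                                (cong (λ k → suc (mersenne m + k)) (+-identityʳ (suc (mersenne m))))

bits↔ : ∀ m → Vec Bool m ↔ Fin (suc (mersenne m))
bits↔ zero    = mk↔ₛ′ (λ _ → zero) (λ _ → []) (λ { zero → refl ; (suc ()) }) (λ { [] → refl })
bits↔ (suc m) = ↔-trans uncons↔ (↔-trans Bool×↔⊎ (↔-trans (⊎-cong (bits↔ m) (bits↔ m)) (↔-sym +↔⊎)))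

bits-zeros : ∀ m → Inverse.to (bits↔ m) zeros ≡ zero
bits-zeros zero    = refl
bits-zeros (suc m) = cong (_↑ˡ _) (bits-zeros m)

-- Labelling X by Boolean vectors

module Labelling (k : ℕ) {v} (T : Subset v)
                 (∣T∣≡ : ∣ T ∣ ≡ mersenne k * 4) (∣∁T∣≡ : ∣ ∁ T ∣ ≡ suc (mersenne k * 4)) where

  P : ℕ
  P = mersenne k

  Y : Set
  Y = Pos × Vec Bool k

  infixl 6 _⊕ʸ_
  _⊕ʸ_ : Y → Y → Y
  (p , u) ⊕ʸ (q , w) = p ⊕ q , u ⊕ w

  _≟ʸ_ : DecidableEquality Y
  _≟ʸ_ = ×-≡-dec _≟ᵖ_ (Vec-≡-dec _≟ᵇ_)

  β : Y → Bool
  β = head ∘′ proj₁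

  Hole : Y → Set
  Hole (p , w) = w ≡ zeros × p ≢ c₀

  Code : Set
  Code = Fin (P * 4) ⊎ Fin (suc (P * 4))

  private
    module Cosets = Inverse (bits↔ k)

    cells : Fin (P * 4) ↔ (Fin P × Vec Bool 2)
    cells = ↔-trans *↔× (×-cong ↔-refl (↔-sym (bits↔ 2)))
    module Cells = Inverse cells

    parts : Σ (Fin v ↔ Code) λ e → ∀ j → Inverse.from e (inj₂ j) ∉ T
    parts = split↔ T ∣T∣≡ ∣∁T∣≡
    module Parts = Inverse (proj₁ parts)

  cell : Bool → Fin P × Vec Bool 2 → Y
  cell b (i , l) = b ∷ l , Cosets.from (suc i)

  -- The codes are the (p , w) with w ≢ zeros, together with (c₀ , zeros); the left summand,
  -- which will hold T, gets exactly those with head p ≡ true.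
  code : Code → Y
  code (inj₁ j)       = cell true (Cells.to j)
  code (inj₂ zero)    = c₀ , zeros
  code (inj₂ (suc j)) = cell false (Cells.to j)

  decodeAt : Pos → Fin (suc P) → Maybe Code
  decodeAt p           zero    = if does (p ≟ᵖ c₀) then just (inj₂ zero) else nothing
  decodeAt (true  ∷ l) (suc i) = just (inj₁ (Cells.from (i , l)))
  decodeAt (false ∷ l) (suc i) = just (inj₂ (suc (Cells.from (i , l))))

  decode : Y → Maybe Code
  decode (p , w) = decodeAt p (Cosets.to w)

  decode-cell : ∀ b i l → decode (cell b (i , l)) ≡ decodeAt (b ∷ l) (suc i)
  decode-cell b i l = cong (decodeAt (b ∷ l)) (Cosets.strictlyInverseˡ (suc i))

  decode-code : ∀ c → decode (code c) ≡ just c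
  decode-code (inj₁ j)       = trans (decode-cell true _ _) (cong (just ∘′ inj₁) (Cells.strictlyInverseʳ j))
  decode-code (inj₂ zero)    = cong (decodeAt c₀) (bits-zeros k)
  decode-code (inj₂ (suc j)) =
    trans (decode-cell false _ _) (cong (just ∘′ inj₂ ∘′ suc) (Cells.strictlyInverseʳ j))

  coset-zero : ∀ {w} → Cosets.to w ≡ zero → w ≡ zeros
  coset-zero w↦0 = Injection.injective (↔⇒↣ (bits↔ k)) (trans w↦0 (sym (bits-zeros k)))

  coset-suc : ∀ {w i} → Cosets.to w ≡ suc i → Cosets.from (suc i) ≡ w
  coset-suc {w} w↦i = trans (cong Cosets.from (sym w↦i)) (Cosets.strictlyInverseʳ w)

  code-decode : ∀ d {c} → decode d ≡ just c → code c ≡ d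
  code-decode (p , w) d↦c with Cosets.to w in w↦
  code-decode (p , w) d↦c | zero with p ≟ᵖ c₀
  code-decode (p , w) refl | zero | yes refl = cong (c₀ ,_) (sym (coset-zero w↦))
  code-decode (true ∷ l , w) refl | suc i =
    trans (cong (cell true) (Cells.strictlyInverseˡ (i , l))) (cong (true ∷ l ,_) (coset-suc w↦))
  code-decode (false ∷ l , w) refl | suc i =
    trans (cong (cell false) (Cells.strictlyInverseˡ (i , l))) (cong (false ∷ l ,_) (coset-suc w↦))

  decode≡nothing⇒Hole : ∀ d → decode d ≡ nothing → Hole d
  decode≡nothing⇒Hole (p , w) d↦ with Cosets.to w in w↦
  decode≡nothing⇒Hole (p , w) d↦ | zero with p ≟ᵖ c₀
  ... | no p≢c₀ = coset-zero w↦ , p≢c₀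
  decode≡nothing⇒Hole (true  ∷ l , w) () | suc i
  decode≡nothing⇒Hole (false ∷ l , w) () | suc i

  Hole⇒decode≡nothing : ∀ d → Hole d → decode d ≡ nothing
  Hole⇒decode≡nothing (p , w) (refl , p≢c₀) rewrite bits-zeros k with p ≟ᵖ c₀
  ... | yes p≡c₀ = contradiction p≡c₀ p≢c₀
  ... | no _     = refl

  label : Fin v → Y
  label = code ∘′ Parts.to

  unlabel : Y → Maybe (Fin v)
  unlabel = Maybe.map Parts.from ∘′ decode

  unlabel-label : ∀ x → unlabel (label x) ≡ just x
  unlabel-label x =
    trans (cong (Maybe.map Parts.from) (decode-code (Parts.to x))) (cong just (Parts.strictlyInverseʳ x))

  label-unlabel : ∀ {d x} → unlabel d ≡ just x → label x ≡ d
  label-unlabel {d} d↦x with decode d in d↦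
  ... | just c with refl ← d↦x = trans (cong code (Parts.strictlyInverseˡ c)) (code-decode d d↦)

  unlabel≡nothing⇒Hole : ∀ d → unlabel d ≡ nothing → Hole d
  unlabel≡nothing⇒Hole d d↦ with decode d in d↦′
  ... | nothing = decode≡nothing⇒Hole d d↦′

  Hole⇒unlabel≡nothing : ∀ d → Hole d → unlabel d ≡ nothing
  Hole⇒unlabel≡nothing d d-hole = map-nothing (Hole⇒decode≡nothing d d-hole)

  β-label : ∀ {x} → x ∈ T → β (label x) ≡ true
  β-label {x} x∈T with Parts.to x in x↦
  ... | inj₁ _ = refl
  ... | inj₂ j = contradiction (subst (_∈ T) x≡ x∈T) (proj₂ parts j)
    where
    x≡ : x ≡ Parts.from (inj₂ j)
    x≡ = trans (sym (Parts.strictlyInverseʳ x)) (cong Parts.from x↦)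

  ⊕ʸ-comm : ∀ y z → y ⊕ʸ z ≡ z ⊕ʸ y
  ⊕ʸ-comm (p , u) (q , w) = cong₂ _,_ (⊕-comm p q) (⊕-comm u w)

  ⊕ʸ-cancel : ∀ y z → y ⊕ʸ (y ⊕ʸ z) ≡ z
  ⊕ʸ-cancel (p , u) (q , w) = cong₂ _,_ (⊕-cancel p q) (⊕-cancel u w)

  β-⊕ : ∀ y z → β (y ⊕ʸ z) ≡ β y xor β z
  β-⊕ ((_ ∷ _) , _) ((_ ∷ _) , _) = refl

  unlabel-self : ∀ y → unlabel (y ⊕ʸ y) ≡ nothing
  unlabel-self (p , u) =
    Hole⇒unlabel≡nothing _ (⊕-self u , λ p⊕p≡c₀ → contradiction (trans (sym (⊕-self p)) p⊕p≡c₀) λ ())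

  infixl 7 _∘_
  _∘_ : Y → Y → Y
  (p , u) ∘ (q , _) = third p q , u

  private
    local⇒adjacent : ∀ {y z} → y ≢ z → unlabel (y ⊕ʸ z) ≡ nothing →
                     proj₂ y ≡ proj₂ z × Adjacent (proj₁ y) (proj₁ z)
    local⇒adjacent {p , u} {q , w} y≢z yz↦ with unlabel≡nothing⇒Hole _ yz↦
    ... | u⊕w≡0 , p⊕q≢c₀ = u≡w , (λ p≡q → y≢z (cong₂ _,_ p≡q u≡w)) , p⊕q≢c₀
      where
      u≡w : u ≡ w
      u≡w = ⊕≡zeros⇒≡ u⊕w≡0

  ∘-comm : ∀ {y z} → y ≢ z → unlabel (y ⊕ʸ z) ≡ nothing → y ∘ z ≡ z ∘ y
  ∘-comm y≢z yz↦ = let (u≡w , adj) = local⇒adjacent y≢z yz↦ in cong₂ _,_ (third-comm adj) u≡w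

  ∘-local : ∀ {y z} → y ≢ z → unlabel (y ⊕ʸ z) ≡ nothing → y ≢ y ∘ z × unlabel (y ⊕ʸ (y ∘ z)) ≡ nothing
  ∘-local {p , u} y≢z yz↦ =
    let (p≢r , p⊕r≢c₀) = third-adjacent (proj₂ (local⇒adjacent y≢z yz↦))
    in p≢r ∘′ cong proj₁ , Hole⇒unlabel≡nothing _ (⊕-self u , p⊕r≢c₀)

  ∘-cancel : ∀ {y z} → y ≢ z → unlabel (y ⊕ʸ z) ≡ nothing → y ∘ (y ∘ z) ≡ z
  ∘-cancel y≢z yz↦ = let (u≡w , adj) = local⇒adjacent y≢z yz↦ in cong₂ _,_ (third-cancel adj) u≡w

  ∘-odd : ∀ {y z} → y ≢ z → unlabel (y ⊕ʸ z) ≡ nothing → β y ≡ false → β z ≡ false → β (y ∘ z) ≡ true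
  ∘-odd y≢z yz↦ = third-odd (proj₂ (local⇒adjacent y≢z yz↦))

  H : ℕ
  H = 4 * suc P

  points↔ : (Fin v ⊎ Y) ↔ Fin (v + (H + H))
  points↔ = ↔-trans (⊎-cong ↔-refl Y↔) (↔-sym +↔⊎)
    where
    head↔ : (Vec Bool 3 × Vec Bool k) ↔ (Bool × (Vec Bool 2 × Vec Bool k))
    head↔ = mk↔ₛ′ (λ { ((b ∷ l) , w) → b , l , w }) (λ { (b , l , w) → (b ∷ l) , w })
                   (λ _ → refl) (λ { ((_ ∷ _) , _) → refl })
    R↔ : (Vec Bool 2 × Vec Bool k) ↔ Fin H
    R↔ = ↔-trans (×-cong (bits↔ 2) (bits↔ k)) (↔-sym *↔×)
    Y↔ : Y ↔ Fin (H + H)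
    Y↔ = ↔-trans head↔ (↔-trans Bool×↔⊎ (↔-trans (⊎-cong R↔ R↔) (↔-sym +↔⊎)))

  T′ : Subset (v + (H + H))
  T′ = T ++ (⊤ {H} ++ ⊥ {H})

  points↔-T′ : ∀ a → Inverse.to points↔ a ∈ T′ ⇔ [ _∈ T , (λ y → β y ≡ false) ]′ a
  points↔-T′ (inj₁ x)                 = ↑ˡ∈++⇔ T
  points↔-T′ (inj₂ ((false ∷ _) , _)) =
    ⇔-trans (↑ʳ∈++⇔ T) (⇔-trans (↑ˡ∈++⇔ (⊤ {H})) (mk⇔ (λ _ → refl) (λ _ → ∈⊤)))
  points↔-T′ (inj₂ ((true ∷ _) , _))  =
    ⇔-trans (↑ʳ∈++⇔ T) (⇔-trans (↑ʳ∈++⇔ (⊤ {H})) (mk⇔ (λ i∈⊥ → contradiction i∈⊥ ∉⊥) λ ()))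

  ∣T′∣≡ : ∣ T′ ∣ ≡ ∣ T ∣ + H
  ∣T′∣≡ = begin
    ∣ T′ ∣                              ≡⟨ ∣p++q∣≡∣p∣+∣q∣ T (⊤ {H} ++ ⊥ {H}) ⟩
    ∣ T ∣ + ∣ ⊤ {H} ++ ⊥ {H} ∣          ≡⟨ cong (∣ T ∣ +_) (∣p++q∣≡∣p∣+∣q∣ (⊤ {H}) (⊥ {H})) ⟩
    ∣ T ∣ + (∣ ⊤ {H} ∣ + ∣ ⊥ {H} ∣)     ≡⟨ cong (∣ T ∣ +_) (cong₂ _+_ (∣⊤∣≡n H) (∣⊥∣≡0 H)) ⟩
    ∣ T ∣ + (H + 0)                     ≡⟨ cong (∣ T ∣ +_) (+-identityʳ H) ⟩
    ∣ T ∣ + H                           ∎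
    where open ≡-Reasoning

-- Orders 2ⁿ − 7

Extension : ∀ {v} → STS v → Subset v → ℕ → Set₁
Extension {v} S T v′ =
  Σ (STS v′) λ S′ → Σ (Fin v → Fin v′) λ f → Σ (Subset v′) λ T′ →
    IsEmbedding S S′ f × MaximalIndependent S′ T′ × (∀ x → x ∈ T → f x ∈ T′) × 2 * ∣ T′ ∣ + 1 ≡ v′

∣∁T∣≡1+∣T∣ : ∀ (T : Subset n) → 2 * ∣ T ∣ + 1 ≡ n → ∣ ∁ T ∣ ≡ suc ∣ T ∣
∣∁T∣≡1+∣T∣ {n} T 2∣T∣+1≡n = begin
  ∣ ∁ T ∣                      ≡⟨ ∣∁p∣≡n∸∣p∣ T ⟩
  n ∸ ∣ T ∣                    ≡⟨ cong (_∸ ∣ T ∣) 2∣T∣+1≡n ⟨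
  (2 * ∣ T ∣ + 1) ∸ ∣ T ∣      ≡⟨ cong (_∸ ∣ T ∣) (2t+1≡ ∣ T ∣) ⟩
  (suc ∣ T ∣ + ∣ T ∣) ∸ ∣ T ∣  ≡⟨ m+n∸n≡m (suc ∣ T ∣) ∣ T ∣ ⟩
  suc ∣ T ∣                    ∎
  where
  open ≡-Reasoning
  2t+1≡ : ∀ t → 2 * t + 1 ≡ suc t + t
  2t+1≡ = solve-∀

doubling-extension : ∀ k {v} (S : STS v) (T : Subset v) → MaximalIndependent S T → Nonempty T →
                     ∣ T ∣ ≡ mersenne k * 4 → 2 * ∣ T ∣ + 1 ≡ v →
                     Extension S T (v + (4 * suc (mersenne k) + 4 * suc (mersenne k)))
doubling-extension k {v} S T T-maximal (t₀ , t₀∈T) ∣T∣≡ 2∣T∣+1≡v =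
  triangleSystem , f , T′ , f-embedding , T′-maximal , f-preserves , size
  where
  open BlockProduct S using (_·_; blockQuasigroup; blockQuasigroup-triangulated)
  open Labelling k T ∣T∣≡ (trans (∣∁T∣≡1+∣T∣ T 2∣T∣+1≡v) (cong suc ∣T∣≡))
  open Doubling blockQuasigroup _≟ʸ_ _⊕ʸ_ ⊕ʸ-comm ⊕ʸ-cancel label unlabel unlabel-label label-unlabel
                unlabel-self _∘_ ∘-comm ∘-local ∘-cancel
  open Transport doubled points↔
  open TriangleSystem transported using (triangleSystem; triangleSystem-triangulated)

  f : Fin v → Fin (v + (H + H))
  f = Inverse.to points↔ ∘′ inj₁

  module Old = Triangulated S blockQuasigroup blockQuasigroup-triangulated
  module New = Triangulated triangleSystem transported triangleSystem-triangulated

  T-free×saturated : ProductFree _·_ (_∈ T) × Saturated _·_ (_∈ T)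
  T-free×saturated = Equivalence.to Old.maximal⇔saturated T-maximal

  T′-maximal : MaximalIndependent triangleSystem T′
  T′-maximal = Equivalence.from New.maximal⇔saturated
    ( productFree-transport points↔-T′ (productFree-doubled β β-⊕ β-label ∘-odd (proj₁ T-free×saturated))
    , saturated-transport points↔-T′ (saturated-doubled β β-⊕ β-label ∘-odd (proj₂ T-free×saturated) t₀∈T))

  f-embedding : IsEmbedding S triangleSystem f
  f-embedding = homomorphism⇒embedding {S = S} {S′ = triangleSystem}
    blockQuasigroup-triangulated triangleSystem-triangulated
    f (inj₁-injective ∘′ to-injective) (λ x y → to-homomorphic (inj₁ x) (inj₁ y))

  f-preserves : ∀ x → x ∈ T → f x ∈ T′
  f-preserves x = Equivalence.from (points↔-T′ (inj₁ x))

  size : 2 * ∣ T′ ∣ + 1 ≡ v + (H + H)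
  size = begin
    2 * ∣ T′ ∣ + 1             ≡⟨ cong (λ t → 2 * t + 1) ∣T′∣≡ ⟩
    2 * (∣ T ∣ + H) + 1        ≡⟨ regroup ∣ T ∣ H ⟩
    (2 * ∣ T ∣ + 1) + (H + H)  ≡⟨ cong (_+ (H + H)) 2∣T∣+1≡v ⟩
    v + (H + H)                ∎
    where
    open ≡-Reasoning
    regroup : ∀ t h → 2 * (t + h) + 1 ≡ (2 * t + 1) + (h + h)
    regroup = solve-∀

2^[3+k]∸7≡ : ∀ k → 2 ^ (3 + k) ∸ 7 ≡ suc (8 * mersenne k)
2^[3+k]∸7≡ k = begin
  2 * (2 * (2 * 2 ^ k)) ∸ 7  ≡⟨ cong (λ m → 2 * (2 * (2 * m)) ∸ 7) (2^m≡1+mersenne k) ⟩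
  2 * (2 * (2 * suc M)) ∸ 7  ≡⟨ cong (_∸ 7) (regroup M) ⟩
  suc (8 * M) + 7 ∸ 7        ≡⟨ m+n∸n≡m (suc (8 * M)) 7 ⟩
  suc (8 * M)                ∎
  where
  M : ℕ
  M = mersenne k
  open ≡-Reasoning
  regroup : ∀ M → 2 * (2 * (2 * suc M)) ≡ suc (8 * M) + 7
  regroup = solve-∀

2^[4+k]∸7≡ : ∀ k → let H = 4 * suc (mersenne k) in 2 ^ (3 + k + 1) ∸ 7 ≡ suc (8 * mersenne k) + (H + H)
2^[4+k]∸7≡ k = begin
  2 * (2 * (2 * 2 ^ (k + 1))) ∸ 7      ≡⟨ cong (λ m → 2 * (2 * (2 * 2 ^ m)) ∸ 7) (+-comm k 1) ⟩
  2 * (2 * (2 * (2 * 2 ^ k))) ∸ 7      ≡⟨ cong (λ m → 2 * (2 * (2 * (2 * m))) ∸ 7) (2^m≡1+mersenne k) ⟩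
  2 * (2 * (2 * (2 * suc M))) ∸ 7      ≡⟨ cong (_∸ 7) (regroup M) ⟩
  suc (8 * M) + (H + H) + 7 ∸ 7        ≡⟨ m+n∸n≡m _ 7 ⟩
  suc (8 * M) + (H + H)                ∎
  where
  M H : ℕ
  M = mersenne k
  H = 4 * suc M
  open ≡-Reasoning
  regroup : ∀ M → 2 * (2 * (2 * (2 * suc M))) ≡ suc (8 * M) + (4 * suc M + 4 * suc M) + 7
  regroup = solve-∀

mainTheorem5 : (n : ℕ) → 4 ≤ n →
    (S : STS (2 ^ n ∸ 7)) (T : Subset (2 ^ n ∸ 7)) →
    MaximalIndependent S T → 2 * ∣ T ∣ + 1 ≡ 2 ^ n ∸ 7 →
    Σ (STS (2 ^ (n + 1) ∸ 7)) λ S' →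
    Σ (Fin (2 ^ n ∸ 7) → Fin (2 ^ (n + 1) ∸ 7)) λ f →
    Σ (Subset (2 ^ (n + 1) ∸ 7)) λ T' →
      IsEmbedding S S' f × MaximalIndependent S' T' ×
      (∀ x → x ∈ T → f x ∈ T') × 2 * ∣ T' ∣ + 1 ≡ 2 ^ (n + 1) ∸ 7
mainTheorem5 _ (s≤s (s≤s (s≤s (s≤s (z≤n {j}))))) S T T-maximal 2∣T∣+1≡v =
  subst (Extension S T) (trans (cong (_+ (H + H)) (2^[3+k]∸7≡ k)) (sym (2^[4+k]∸7≡ k)))
    (doubling-extension k S T T-maximal T-nonempty ∣T∣≡ 2∣T∣+1≡v)
  where
  k P H : ℕ
  k = suc j
  P = mersenne k
  H = 4 * suc P

  ∣T∣≡ : ∣ T ∣ ≡ P * 4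
  ∣T∣≡ = *-cancelˡ-≡ ∣ T ∣ (P * 4) 2
           (+-cancelʳ-≡ 1 (2 * ∣ T ∣) (2 * (P * 4)) (trans 2∣T∣+1≡v (trans (2^[3+k]∸7≡ k) (regroup P))))
    where
    regroup : ∀ P → suc (8 * P) ≡ 2 * (P * 4) + 1
    regroup = solve-∀

  T-nonempty : Nonempty T
  T-nonempty = let (x , x∈T , _) = ∣p∣<∣q∣⇒∃∈q∉p {p = ⊥} {T} ∣⊥∣<∣T∣ in x , x∈T
    where
    ∣⊥∣<∣T∣ : ∣ ⊥ {2 ^ (3 + k) ∸ 7} ∣ < ∣ T ∣
    ∣⊥∣<∣T∣ = subst₂ _<_ (sym (∣⊥∣≡0 (2 ^ (3 + k) ∸ 7))) (sym ∣T∣≡)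
                (subst (λ m → 0 < m * 4) (sym (+-suc (mersenne j) (mersenne j))) (s≤s z≤n))
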